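{- Let $P\in\mathbb{Z}[x_1,\ldots,x_n]$ and let $(J_0,\ldots,J_\ell,d_0,\ldots,d_{m-1})$ be an upper Rado functional of order $m$ for $P$, or $(J_0,\ldots,J_\ell,d_1,\ldots,d_m)$ a lower Rado functional of order $m$ for $P$. If $i,j\in\{0,1,\ldots,m\}$, $\alpha\in J_i$ and $\beta\in J_j$ satisfy $\ell(\alpha+\beta)\le2$, then $i=j$ and $|\alpha|=|\beta|$.
   Context: $\mathbb{N}=\{1,2,\ldots\}$, $\mathbb{N}_0=\mathbb{N}\cup\{0\}$. For $P=\sum c_\alpha x^\alpha$, $\mathrm{Supp}(P)=\{\alpha\in\mathbb{N}_0^n:c_\alpha\neq0\}$; $|\alpha|=\sum\alpha_i$; $\ell(\alpha)=|\{i:\alpha_i>0\}|$. A positive linear map is $\phi(\alpha)=t_1\alpha_1+\cdots+t_n\alpha_n$ with $t_i\in\mathbb{N}_0$; for a finite coloring $c$ it is $c$-monochromatic if $\{t_1,\ldots,t_n\}$ is. If $M_0<\cdots<M_\ell$ enumerates $\phi(\mathrm{Supp}(P))$ increasingly, the partition determined by $\phi$ is $(J_0,\ldots,J_\ell)$, $J_i=\{\alpha\in\mathrm{Supp}(P):\phi(\alpha)=M_i\}$. Lower Rado functional of order $m$: a tuple $(J_0,\ldots,J_\ell,d_1,\ldots,d_m)$, $\ell\ge m$, $d_i\in\mathbb{N}$, such that for every finite coloring $c$ of $\mathbb{N}$ and every $k\in\mathbb{N}$ there are infinitely many $c$-monochromatic positive linear maps $\phi$ such that $(J_0,\ldots,J_\ell)$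 is the partition determined by $\phi$, and with $M_0<\cdots<M_\ell$ the increasing enumeration of $\phi(\mathrm{Supp}(P))$, $M_i-M_0=d_i$ for $1\le i\le m$ and $M_{m+1}-M_m\ge k$. Upper Rado functional of order $m$: a tuple $(J_0,\ldots,J_\ell,d_0,\ldots,d_{m-1})$, $\ell\ge m$, $d_i\in\mathbb{N}$, such that for every finite coloring $c$ of $\mathbb{N}$ and every $k\in\mathbb{N}$ there are infinitely many $c$-monochromatic positive linear maps $\phi$ such that $(J_\ell,\ldots,J_0)$ is the partition determined by $\phi$, and with $M_\ell<\cdots<M_0$ the increasing enumeration of $\phi(\mathrm{Supp}(P))$, $M_i-M_m=d_i$ for $0\le i\le m-1$ and $M_m-M_{m+1}\ge k$. -}

module Defs where

open import Data.Nat using (ℕ; zero; suc; _+_; _*_; _∸_; _≤_; _<_)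
open import Data.Integer using (ℤ)
import Data.Integer as ℤ
open import Data.Fin using (Fin; toℕ; opposite)
import Data.Fin as F
open import Data.Vec using (Vec; []; _∷_; zipWith; sum)
open import Data.List using (List)
open import Data.List.Membership.Propositional using (_∈_; _∉_)
open import Data.Product using (Σ; ∃; _×_)
open import Function.Bundles using (_⇔_)
open import Relation.Binary.PropositionalEquality using (_≡_; _≢_)

Exponent : ℕ → Set
Exponent n = Vec ℕ n

record Poly (n : ℕ) : Set where
  field
    coeff    : Exponent n → ℤ
    monos    : List (Exponent n)
    finite   : ∀ α → coeff α ≢ ℤ.0ℤ → α ∈ monos

Supp : ∀ {n} → Poly n → Exponent n → Set
Supp P α = Poly.coeff P α ≢ ℤ.0ℤ

∣_∣ₑ : ∀ {n} → Exponent n → ℕ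
∣ α ∣ₑ = sum α

lenₑ : ∀ {n} → Exponent n → ℕ
lenₑ [] = 0
lenₑ (zero ∷ α) = lenₑ α
lenₑ (suc _ ∷ α) = suc (lenₑ α)

_+ₑ_ : ∀ {n} → Exponent n → Exponent n → Exponent n
α +ₑ β = zipWith _+_ α β

linMap : ∀ {n} → Vec ℕ n → Exponent n → ℕ
linMap t α = sum (zipWith _*_ t α)

-- A finite coloring of ℕ = {1,2,…} with r colors (the value at 0 is irrelevant).
-- φ is c-monochromatic if {t₁,…,tₙ} ⊆ ℕ = {1,2,…} is monochromatic.
Monochromatic : ∀ {r n} → (ℕ → Fin r) → Vec ℕ n → Set
Monochromatic {r} {n} c t =
  Σ (Fin r) λ col → ∀ (i : Fin n) → (1 ≤ Data.Vec.lookup t i) × (c (Data.Vec.lookup t i) ≡ col)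

InfinitelyMany : ∀ {n} → (Vec ℕ n → Set) → Set
InfinitelyMany {n} S = ∀ (L : List (Vec ℕ n)) → Σ (Vec ℕ n) λ t → (t ∉ L) × S t

PartitionBy : ∀ {n ℓ} → Poly n → (Exponent n → ℕ) →
              (Fin (suc ℓ) → Exponent n → Set) → (Fin (suc ℓ) → ℕ) → Set
PartitionBy {n} {ℓ} P φ J M =
  (∀ (i j : Fin (suc ℓ)) → i F.< j → M i < M j) ×
  (∀ (i : Fin (suc ℓ)) → Σ (Exponent n) λ α → Supp P α × (φ α ≡ M i)) ×
  (∀ (α : Exponent n) → Supp P α → Σ (Fin (suc ℓ)) λ i → φ α ≡ M i) ×
  (∀ (i : Fin (suc ℓ)) (α : Exponent n) → J i α ⇔ (Supp P α × (φ α ≡ M i)))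

-- Lower Rado functional of order m: (J₀,…,J_ℓ, d₁,…,d_m), where d (j) stands for d_{j+1}.
LowerRado : ∀ {n} (P : Poly n) (ℓ m : ℕ) → (Fin (suc ℓ) → Exponent n → Set) → (Fin m → ℕ) → Set
LowerRado {n} P ℓ m J d =
  (m ≤ ℓ) × (∀ j → 1 ≤ d j) ×
  (∀ (r : ℕ) (c : ℕ → Fin r) (k : ℕ) → InfinitelyMany λ t →
     Monochromatic c t ×
     Σ (Fin (suc ℓ) → ℕ) λ M →
       PartitionBy P (linMap t) J M ×
       (∀ (i : Fin (suc ℓ)) (j : Fin m) → toℕ i ≡ suc (toℕ j) → M i ∸ M F.zero ≡ d j) ×
       (∀ (i i' : Fin (suc ℓ)) → toℕ i ≡ m → toℕ i' ≡ suc m → k ≤ M i' ∸ M i))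

-- Upper Rado functional of order m: (J₀,…,J_ℓ, d₀,…,d_{m-1}), d (j) stands for d_j.
-- (J_ℓ,…,J₀) is the partition determined by φ, and M_ℓ < ⋯ < M₀ is the increasing
-- enumeration; here M is indexed as in the paper, so M ∘ opposite is increasing.
UpperRado : ∀ {n} (P : Poly n) (ℓ m : ℕ) → (Fin (suc ℓ) → Exponent n → Set) → (Fin m → ℕ) → Set
UpperRado {n} P ℓ m J d =
  (m ≤ ℓ) × (∀ j → 1 ≤ d j) ×
  (∀ (r : ℕ) (c : ℕ → Fin r) (k : ℕ) → InfinitelyMany λ t →
     Monochromatic c t ×
     Σ (Fin (suc ℓ) → ℕ) λ M →
       PartitionBy P (linMap t) (λ i → J (opposite i)) (λ i → M (opposite i)) ×
       (∀ (i im : Fin (suc ℓ)) (j : Fin m) → toℕ i ≡ toℕ j → toℕ im ≡ m → M i ∸ M im ≡ d j) ×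
       (∀ (i i' : Fin (suc ℓ)) → toℕ i ≡ m → toℕ i' ≡ suc m → k ≤ M i ∸ M i'))

-- The Rado functional provides offsets c₁, c₂,
-- independent of φ, with φ(α) − c₁ = φ(β) − c₂ for infinitely many monochromatic φ under
-- every finite colouring.  As ℓ(α + β) ≤ 2, this reads a₁x + a₂y + c₂ = b₁x + b₂y + c₁ for two
-- entries x, y of φ, where a₁ + a₂ = |α| and b₁ + b₂ = |β|.  If |α| = |β| + G with G ≥ 1, the
-- substitution X = Gx + c₂ − c₁ makes the equation homogeneous, and Rado's colouring by the last
-- nonzero digit in base K! + 1 (K = |α| + |β|) leaves it without monochromatic solutions: the
-- coefficient differences p, q, p − q are units modulo the base.  Hence |α| = |β|; colouring by
-- residues modulo a number exceeding c₁ and c₂ then forces c₁ = c₂, so φ(α) = φ(β) and i = j.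

module Submission where

open import Defs
open import Data.Nat using (ℕ; zero; suc; _+_; _*_; _∸_; _^_; _≤_; _<_; _≤?_; _<?_; z≤n; s≤s;
                            NonZero; >-nonZero; ≢-nonZero; _!)
open import Data.Nat.Properties
open import Data.Nat.DivMod using (_%_; _/_; m%n<n; m≡m%n+[m/n]*n; m/n<m; [m+kn]%n≡m%n; m<n⇒m%n≡m)
open import Data.Nat.Divisibility
  using (_∣_; divides; ∣m+n∣m⇒∣n; ∣1⇒≡1; n∣m*n; m∣m*n; ∣-trans; ∣⇒≤; n∣m⇒m%n≡0; m≤n⇒m!∣n!)
open import Data.Nat.Coprimality using (Coprime; coprime-divisor)
open import Data.Nat.Tactic.RingSolver using (solve-∀)
open import Data.Fin using (Fin; toℕ; fromℕ<)
import Data.Fin as Fin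
open import Data.Fin.Properties using (toℕ-fromℕ<; toℕ-injective; opposite-involutive) renaming (<-cmp to <-cmpᶠ)
open import Data.Vec using (Vec; []; _∷_; lookup; map; replicate)
open import Data.Vec.Properties using (zipWith-comm)
open import Data.Vec.Relation.Unary.All using (All; []; _∷_; zip)
import Data.Vec.Relation.Unary.All as All
open import Data.Vec.Relation.Unary.All.Properties using (lookup⁻; lookup⁺)
open import Data.List using (List; []; _∷_; upTo)
import Data.List as List
open import Data.List.Membership.Propositional using (_∈_; _∉_)
open import Data.List.Membership.Propositional.Properties using (∈-map⁺; ∈-upTo⁺)
open import Data.Product using (Σ; _×_; _,_; proj₁; proj₂)
open import Data.Sum using (_⊎_; inj₁; inj₂)
open import Data.Empty using (⊥; ⊥-elim)
open import Function using (_∘_)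
open import Function.Bundles using (Equivalence)
open import Function.Definitions using (Injective)
open import Relation.Nullary using (¬_; yes; no)
open import Relation.Binary.Definitions using (tri<; tri≈; tri>)
open import Relation.Binary.PropositionalEquality

CoprimeUpTo : ℕ → ℕ → Set
CoprimeUpTo N K = ∀ {a} → 1 ≤ a → a ≤ K → Coprime N a

suc-!-coprimeUpTo : ∀ K → CoprimeUpTo (suc (K !)) K
suc-!-coprimeUpTo K {suc a} _ a<K {d} (d∣1+K! , d∣a) =
  ∣1⇒≡1 (∣m+n∣m⇒∣n (subst (d ∣_) (+-comm 1 (K !)) d∣1+K!) (∣-trans d∣a a∣K!))
  where
  a∣K! : suc a ∣ K !
  a∣K! = ∣-trans (m∣m*n (a !)) (m≤n⇒m!∣n! a<K)

module _ (N : ℕ) .{{_ : NonZero N}} where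

  record LastDigit (X ρ : ℕ) : Set where
    field
      exponent      : ℕ
      cofactor      : ℕ
      decomposition : X ≡ N ^ exponent * cofactor
      cofactor%N    : cofactor % N ≡ ρ
      nonzero       : ρ ≢ 0

  -- The fuel argument is a bound on X; with fuel 0 the result is a junk value.
  lastDigitWithin : ℕ → ℕ → ℕ
  lastDigitWithin zero    X = X % N
  lastDigitWithin (suc f) X with X % N
  ... | zero  = lastDigitWithin f (X / N)
  ... | suc r = suc r

  lastDigit : ℕ → ℕ
  lastDigit X = lastDigitWithin X X

  lastDigitWithin<N : ∀ f X → lastDigitWithin f X < N
  lastDigitWithin<N zero    X = m%n<n X N
  lastDigitWithin<N (suc f) X with X % N in eq
  ... | zero  = lastDigitWithin<N f (X / N)
  ... | suc r = subst (_< N) eq (m%n<n X N)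

  lastDigitWithin-spec : 1 < N → ∀ f X → 0 < X → X ≤ f → LastDigit X (lastDigitWithin f X)
  lastDigitWithin-spec 1<N zero    X (s≤s _) ()
  lastDigitWithin-spec 1<N (suc f) X 0<X X≤f with X % N in eq
  ... | suc r = record
    { exponent = 0 ; cofactor = X ; decomposition = sym (*-identityˡ X)
    ; cofactor%N = eq ; nonzero = λ () }
  ... | zero = record
    { exponent = suc exponent ; cofactor = cofactor
    ; decomposition = X≡N^suc[u]*w
    ; cofactor%N = cofactor%N ; nonzero = nonzero }
    where
    X≡X/N*N : X ≡ X / N * N
    X≡X/N*N = trans (m≡m%n+[m/n]*n X N) (cong (_+ X / N * N) eq)
    0<X/N : 0 < X / N
    0<X/N = n≢0⇒n>0 λ X/N≡0 → <⇒≢ 0<X (sym (trans X≡X/N*N (cong (_* N) X/N≡0)))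
    X/N<X : X / N < X
    X/N<X = m/n<m X N {{>-nonZero 0<X}} 1<N
    open LastDigit (lastDigitWithin-spec 1<N f (X / N) 0<X/N (≤-pred (<-≤-trans X/N<X X≤f)))
    X≡N^suc[u]*w : X ≡ N * N ^ exponent * cofactor
    X≡N^suc[u]*w = begin
      X                             ≡⟨ X≡X/N*N ⟩
      X / N * N                     ≡⟨ cong (_* N) decomposition ⟩
      N ^ exponent * cofactor * N   ≡⟨ *-comm _ N ⟩
      N * (N ^ exponent * cofactor) ≡⟨ *-assoc N _ _ ⟨
      N * N ^ exponent * cofactor   ∎
      where open ≡-Reasoning

  residue-cancel : ∀ {D q w₁ w₂} → (D + q) * w₁ ≡ q * w₂ → w₁ % N ≡ w₂ % N → N ∣ D * (w₁ % N)
  residue-cancel {D} {q} {w₁} {w₂} eq residues = ∣m+n∣m⇒∣n N∣sum (n∣m*n ((D + q) * k₁))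
    where
    open ≡-Reasoning
    r k₁ k₂ : ℕ
    r  = w₁ % N
    k₁ = w₁ / N
    k₂ = w₂ / N
    expanded : (D + q) * k₁ * N + D * r + q * r ≡ q * k₂ * N + q * r
    expanded = begin
      (D + q) * k₁ * N + D * r + q * r  ≡⟨ expandˡ D q k₁ N r ⟩
      (D + q) * (r + k₁ * N)            ≡⟨ cong ((D + q) *_) (m≡m%n+[m/n]*n w₁ N) ⟨
      (D + q) * w₁                      ≡⟨ eq ⟩
      q * w₂                            ≡⟨ cong (q *_) (m≡m%n+[m/n]*n w₂ N) ⟩
      q * (w₂ % N + k₂ * N)             ≡⟨ cong (λ s → q * (s + k₂ * N)) residues ⟨
      q * (r + k₂ * N)                  ≡⟨ expandʳ q r k₂ N ⟩
      q * k₂ * N + q * r                ∎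
      where
      expandˡ : ∀ D q k N r → (D + q) * k * N + D * r + q * r ≡ (D + q) * (r + k * N)
      expandˡ = solve-∀
      expandʳ : ∀ q r k N → q * (r + k * N) ≡ q * k * N + q * r
      expandʳ = solve-∀
    N∣sum : N ∣ (D + q) * k₁ * N + D * r
    N∣sum = divides (q * k₂) (+-cancelʳ-≡ (q * r) _ _ expanded)

  -- Induction on the exponents: distinct exponents make N divide a cofactor, equal ones give
  -- (p − q) ρ ≡ 0 (mod N).
  sameLastDigit⇒multiples≢ : ∀ {p q X Y ρ} → q < p → Coprime N p → Coprime N q → Coprime N (p ∸ q) →
                             LastDigit X ρ → LastDigit Y ρ → p * X ≢ q * Y
  sameLastDigit⇒multiples≢ {p} {q} {ρ = ρ} q<p coprime-p coprime-q coprime-p∸q digitX digitY =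
    go (exponent digitX) (exponent digitY) (decomposition digitX) (decomposition digitY)
    where
    open LastDigit
    w₁ w₂ : ℕ
    w₁ = cofactor digitX
    w₂ = cofactor digitY

    N∤cofactor : ∀ {w} → w % N ≡ ρ → ¬ N ∣ w
    N∤cofactor w%N N∣w = nonzero digitX (trans (sym w%N) (n∣m⇒m%n≡0 _ N N∣w))

    sameExponent : p * w₁ ≢ q * w₂
    sameExponent eq = <⇒≱ ρ<N (∣⇒≤ {{≢-nonZero (nonzero digitX)}} N∣ρ)
      where
      ρ<N : ρ < N
      ρ<N = subst (_< N) (cofactor%N digitX) (m%n<n w₁ N)
      p≡D+q : p ≡ (p ∸ q) + q
      p≡D+q = sym (m∸n+n≡m (<⇒≤ q<p))
      N∣ρ : N ∣ ρ
      N∣ρ = coprime-divisor coprime-p∸q (subst (λ s → N ∣ (p ∸ q) * s) (cofactor%N digitX)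
              (residue-cancel {p ∸ q} {q} {w₁} {w₂} (subst (λ s → s * w₁ ≡ q * w₂) p≡D+q eq)
                (trans (cofactor%N digitX) (sym (cofactor%N digitY)))))

    lowerExponent : ∀ {a b w w′} v → a * w ≡ b * (N * N ^ v * w′) → Coprime N a → w % N ≡ ρ → ⊥
    lowerExponent {a} {b} {w} {w′} v eq coprime-a w%N = N∤cofactor w%N
      (coprime-divisor coprime-a (divides (b * N ^ v * w′) (trans eq (reorder b N (N ^ v) w′))))
      where
      reorder : ∀ b N p w′ → b * (N * p * w′) ≡ b * p * w′ * N
      reorder = solve-∀

    go : ∀ u v {X Y} → X ≡ N ^ u * w₁ → Y ≡ N ^ v * w₂ → p * X ≢ q * Y
    go zero zero refl refl eq = sameExponent
      (subst₂ (λ s s′ → p * s ≡ q * s′) (*-identityˡ w₁) (*-identityˡ w₂) eq)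
    go zero (suc v) refl refl eq =
      lowerExponent {p} {q} {w₁} {w₂} v (subst (λ s → p * s ≡ q * (N * N ^ v * w₂)) (*-identityˡ w₁) eq)
        coprime-p (cofactor%N digitX)
    go (suc u) zero refl refl eq =
      lowerExponent {q} {p} {w₂} {w₁} u (subst (λ s → q * s ≡ p * (N * N ^ u * w₁)) (*-identityˡ w₂) (sym eq))
        coprime-q (cofactor%N digitY)
    go (suc u) (suc v) refl refl eq = go u v refl refl (*-cancelˡ-≡ _ _ N (begin
      N * (p * (N ^ u * w₁))  ≡⟨ shuffle N p (N ^ u) w₁ ⟩
      p * (N * N ^ u * w₁)    ≡⟨ eq ⟩
      q * (N * N ^ v * w₂)    ≡⟨ shuffle N q (N ^ v) w₂ ⟨
      N * (q * (N ^ v * w₂))  ∎))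
      where
      open ≡-Reasoning
      shuffle : ∀ N p P w → N * (p * (P * w)) ≡ p * (N * P * w)
      shuffle = solve-∀

positiveCombination≢0 : ∀ {p p′ X Y} → 1 ≤ p + p′ → 1 ≤ X → 1 ≤ Y → p * X + p′ * Y ≢ 0
positiveCombination≢0 {p} {p′} {X} {Y} 1≤p+p′ 1≤X 1≤Y eq = <⇒≢ 0<combination (sym eq)
  where
  0<combination : 0 < p * X + p′ * Y
  0<combination = ≤-trans 1≤p+p′ (subst (_≤ p * X + p′ * Y) (cong₂ _+_ (*-identityʳ p) (*-identityʳ p′))
                    (+-mono-≤ (*-mono-≤ (≤-refl {p}) 1≤X) (*-mono-≤ (≤-refl {p′}) 1≤Y)))

cross-cancel : ∀ b a p q X Y → (b + p) * X + a * Y ≡ b * X + (a + q) * Y → p * X ≡ q * Y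
cross-cancel b a p q X Y eq = +-cancelˡ-≡ (b * X + a * Y) _ _ (begin
  b * X + a * Y + p * X    ≡⟨ shuffleˡ b a p X Y ⟩
  (b + p) * X + a * Y      ≡⟨ eq ⟩
  b * X + (a + q) * Y      ≡⟨ shuffleʳ b a q X Y ⟩
  b * X + a * Y + q * Y    ∎)
  where
  open ≡-Reasoning
  shuffleˡ : ∀ u v w U V → u * U + v * V + w * U ≡ (u + w) * U + v * V
  shuffleˡ = solve-∀
  shuffleʳ : ∀ u v w U V → u * U + (v + w) * V ≡ u * U + v * V + w * V
  shuffleʳ = solve-∀

cross-excess : ∀ b a p q G → b + p + a ≡ b + (a + q) + G → p ≡ q + G
cross-excess b a p q G eq = +-cancelˡ-≡ (b + a) _ _ (begin
  b + a + p        ≡⟨ shuffleˡ b a p ⟩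
  b + p + a        ≡⟨ eq ⟩
  b + (a + q) + G  ≡⟨ +-assoc b (a + q) G ⟩
  b + (a + q + G)  ≡⟨ cong (b +_) (+-assoc a q G) ⟩
  b + (a + (q + G)) ≡⟨ +-assoc b a (q + G) ⟨
  b + a + (q + G)  ∎)
  where
  open ≡-Reasoning
  shuffleˡ : ∀ u v w → u + v + w ≡ u + w + v
  shuffleˡ = solve-∀

module _ {N K G ρ : ℕ} .{{_ : NonZero N}} (coprime : CoprimeUpTo N K) (1≤G : 1 ≤ G) where

  excessMultiples≢ : ∀ {p q X Y} → p ≡ q + G → p ≤ K → 1 ≤ X →
                     LastDigit N X ρ → LastDigit N Y ρ → p * X ≢ q * Y
  excessMultiples≢ {p} {zero} p≡G _ 1≤X _ _ pX≡0 =
    <⇒≢ (*-mono-≤ (subst (1 ≤_) (sym p≡G) 1≤G) 1≤X) (sym pX≡0)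
  excessMultiples≢ {p} {suc q} p≡q+G p≤K _ digitX digitY =
    sameLastDigit⇒multiples≢ N q<p (coprime (≤-trans (s≤s z≤n) q<p) p≤K)
      (coprime (s≤s z≤n) (≤-trans (<⇒≤ q<p) p≤K))
      (coprime (subst (1 ≤_) (sym p∸q≡G) 1≤G) (≤-trans (m∸n≤m p (suc q)) p≤K)) digitX digitY
    where
    q<p : suc q < p
    q<p = subst (suc q <_) (sym p≡q+G) (m<m+n (suc q) 1≤G)
    p∸q≡G : p ∸ suc q ≡ G
    p∸q≡G = trans (cong (_∸ suc q) p≡q+G) (m+n∸m≡n (suc q) G)

  noHomogeneousSolution : ∀ {a₁ a₂ b₁ b₂ X Y} → a₁ + a₂ ≡ b₁ + b₂ + G → a₁ + a₂ ≤ K → 1 ≤ X → 1 ≤ Y →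
                          LastDigit N X ρ → LastDigit N Y ρ → a₁ * X + a₂ * Y ≢ b₁ * X + b₂ * Y
  noHomogeneousSolution {a₁} {a₂} {b₁} {b₂} {X} {Y} sums bound 1≤X 1≤Y digitX digitY eq
    with ≤-total b₁ a₁ | ≤-total b₂ a₂
  ... | inj₂ a₁≤b₁ | inj₂ a₂≤b₂ = <-irrefl refl
    (≤-<-trans (+-mono-≤ a₁≤b₁ a₂≤b₂) (subst (b₁ + b₂ <_) (sym sums) (m<m+n (b₁ + b₂) 1≤G)))
  ... | inj₁ b₁≤a₁ | inj₁ b₂≤a₂
    with p , refl ← m≤n⇒∃[o]m+o≡n b₁≤a₁ | p′ , refl ← m≤n⇒∃[o]m+o≡n b₂≤a₂ =
    positiveCombination≢0 {p} {p′} (subst (1 ≤_) (sym p+p′≡G) 1≤G) 1≤X 1≤Y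
      (+-cancelˡ-≡ (b₁ * X + b₂ * Y) _ _ (trans (expand b₁ b₂ p p′ X Y) (trans eq (sym (+-identityʳ _)))))
    where
    expand : ∀ b₁ b₂ p p′ X Y → b₁ * X + b₂ * Y + (p * X + p′ * Y) ≡ (b₁ + p) * X + (b₂ + p′) * Y
    expand = solve-∀
    regroup : ∀ b₁ b₂ p p′ → b₁ + b₂ + (p + p′) ≡ b₁ + p + (b₂ + p′)
    regroup = solve-∀
    p+p′≡G : p + p′ ≡ G
    p+p′≡G = +-cancelˡ-≡ (b₁ + b₂) _ _ (trans (regroup b₁ b₂ p p′) sums)
  ... | inj₁ b₁≤a₁ | inj₂ a₂≤b₂
    with p , refl ← m≤n⇒∃[o]m+o≡n b₁≤a₁ | q , refl ← m≤n⇒∃[o]m+o≡n a₂≤b₂ =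
    excessMultiples≢ (cross-excess b₁ a₂ p q G sums) (≤-trans (≤-trans (m≤n+m p b₁) (m≤m+n _ a₂)) bound)
      1≤X digitX digitY (cross-cancel b₁ a₂ p q X Y eq)
  ... | inj₂ a₁≤b₁ | inj₁ b₂≤a₂
    with q , refl ← m≤n⇒∃[o]m+o≡n a₁≤b₁ | p , refl ← m≤n⇒∃[o]m+o≡n b₂≤a₂ =
    excessMultiples≢ (cross-excess b₂ a₁ p q G swappedSums) (≤-trans (≤-trans (m≤n+m p b₂) (m≤n+m _ a₁)) bound)
      1≤Y digitY digitX (cross-cancel b₂ a₁ p q Y X swappedEq)
    where
    swappedSums : b₂ + p + a₁ ≡ b₂ + (a₁ + q) + G
    swappedSums = trans (+-comm (b₂ + p) a₁) (trans sums (cong (_+ G) (+-comm (a₁ + q) b₂)))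
    swappedEq : (b₂ + p) * Y + a₁ * X ≡ b₂ * Y + (a₁ + q) * X
    swappedEq = trans (+-comm ((b₂ + p) * Y) (a₁ * X)) (trans eq (+-comm ((a₁ + q) * X) (b₂ * Y)))

homogenise : ∀ {a₁ a₂ b₁ b₂ x y G c₁ c₂ X Y} →
             x * a₁ + y * a₂ + c₂ ≡ x * b₁ + y * b₂ + c₁ → a₁ + a₂ ≡ b₁ + b₂ + G →
             X + c₁ ≡ G * x + c₂ → Y + c₁ ≡ G * y + c₂ → a₁ * X + a₂ * Y ≡ b₁ * X + b₂ * Y
homogenise {a₁} {a₂} {b₁} {b₂} {x} {y} {G} {c₁} {c₂} {X} {Y} eq sums X+c₁ Y+c₁ =
  +-cancelʳ-≡ ((a₁ + a₂) * c₁) _ _ (+-cancelʳ-≡ (G * c₂) _ _ (begin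
    a₁ * X + a₂ * Y + (a₁ + a₂) * c₁ + G * c₂          ≡⟨ cong (_+ G * c₂) (weighted a₁ a₂) ⟩
    G * (x * a₁ + y * a₂) + (a₁ + a₂) * c₂ + G * c₂    ≡⟨ pull-c₂ G (x * a₁ + y * a₂) (a₁ + a₂) c₂ ⟩
    G * (x * a₁ + y * a₂ + c₂) + (a₁ + a₂) * c₂        ≡⟨ cong₂ (λ u v → G * u + v * c₂) eq sums ⟩
    G * (x * b₁ + y * b₂ + c₁) + (b₁ + b₂ + G) * c₂    ≡⟨ push-c₁ G (x * b₁ + y * b₂) (b₁ + b₂) c₁ c₂ ⟩
    G * (x * b₁ + y * b₂) + (b₁ + b₂) * c₂ + G * c₁ + G * c₂
                                                        ≡⟨ cong (λ u → u + G * c₁ + G * c₂) (weighted b₁ b₂) ⟨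
    b₁ * X + b₂ * Y + (b₁ + b₂) * c₁ + G * c₁ + G * c₂ ≡⟨ merge-c₁ (b₁ * X + b₂ * Y) (b₁ + b₂) G c₁ c₂ ⟩
    b₁ * X + b₂ * Y + (b₁ + b₂ + G) * c₁ + G * c₂      ≡⟨ cong (λ s → b₁ * X + b₂ * Y + s * c₁ + G * c₂) sums ⟨
    b₁ * X + b₂ * Y + (a₁ + a₂) * c₁ + G * c₂          ∎))
  where
  open ≡-Reasoning
  pull-c₂ : ∀ G P S c → G * P + S * c + G * c ≡ G * (P + c) + S * c
  pull-c₂ = solve-∀
  push-c₁ : ∀ G R S c c′ → G * (R + c) + (S + G) * c′ ≡ G * R + S * c′ + G * c + G * c′
  push-c₁ = solve-∀
  merge-c₁ : ∀ L S G c c′ → L + S * c + G * c + G * c′ ≡ L + (S + G) * c + G * c′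
  merge-c₁ = solve-∀
  collect : ∀ u v X Y c → u * X + v * Y + (u + v) * c ≡ u * (X + c) + v * (Y + c)
  collect = solve-∀
  expand : ∀ u v G x y c → u * (G * x + c) + v * (G * y + c) ≡ G * (x * u + y * v) + (u + v) * c
  expand = solve-∀
  weighted : ∀ u v → u * X + v * Y + (u + v) * c₁ ≡ G * (x * u + y * v) + (u + v) * c₂
  weighted u v = begin
    u * X + v * Y + (u + v) * c₁          ≡⟨ collect u v X Y c₁ ⟩
    u * (X + c₁) + v * (Y + c₁)           ≡⟨ cong₂ (λ s s′ → u * s + v * s′) X+c₁ Y+c₁ ⟩
    u * (G * x + c₂) + v * (G * y + c₂)   ≡⟨ expand u v G x y c₂ ⟩
    G * (x * u + y * v) + (u + v) * c₂    ∎

record OneEntry (Q : ℕ → Set) {n} (t α β : Vec ℕ n) : Set where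
  constructor oneEntry
  field
    x a b : ℕ
    Qx    : Q x
    φα    : linMap t α ≡ x * a
    φβ    : linMap t β ≡ x * b
    ∣α∣   : ∣ α ∣ₑ ≡ a
    ∣β∣   : ∣ β ∣ₑ ≡ b

record TwoEntries (Q : ℕ → Set) {n} (t α β : Vec ℕ n) : Set where
  constructor twoEntries
  field
    x y a₁ a₂ b₁ b₂ : ℕ
    Qx              : Q x
    Qy              : Q y
    φα              : linMap t α ≡ x * a₁ + y * a₂
    φβ              : linMap t β ≡ x * b₁ + y * b₂
    ∣α∣             : ∣ α ∣ₑ ≡ a₁ + a₂
    ∣β∣             : ∣ β ∣ₑ ≡ b₁ + b₂

support₀ : ∀ {n} (t α β : Vec ℕ n) → lenₑ (α +ₑ β) ≡ 0 →
           linMap t α ≡ 0 × linMap t β ≡ 0 × ∣ α ∣ₑ ≡ 0 × ∣ β ∣ₑ ≡ 0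
support₀ []      []         []         _ = refl , refl , refl , refl
support₀ (x ∷ t) (zero ∷ α) (zero ∷ β) ℓ≡0 with φα , φβ , ∣α∣ , ∣β∣ ← support₀ t α β ℓ≡0 =
  cong₂ _+_ (*-zeroʳ x) φα , cong₂ _+_ (*-zeroʳ x) φβ , ∣α∣ , ∣β∣

-- The default z stands in for an entry of t whose coefficients all vanish.
support≤1 : ∀ {Q : ℕ → Set} {n} {t α β : Vec ℕ n} {z} → All Q t → Q z →
            lenₑ (α +ₑ β) ≤ 1 → OneEntry Q t α β
support≤1 {t = []} {[]} {[]} {z} [] Qz _ = oneEntry z 0 0 Qz (sym (*-zeroʳ z)) (sym (*-zeroʳ z)) refl refl
support≤1 {t = x ∷ t} {zero ∷ α} {zero ∷ β} (_ ∷ Qt) Qz ℓ≤1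
  with oneEntry y a b Qy φα φβ ∣α∣ ∣β∣ ← support≤1 Qt Qz ℓ≤1 =
  oneEntry y a b Qy (cong₂ _+_ (*-zeroʳ x) φα) (cong₂ _+_ (*-zeroʳ x) φβ) ∣α∣ ∣β∣
support≤1 {t = x ∷ t} {zero ∷ α} {suc b ∷ β} (Qx ∷ _) _ (s≤s ℓ≤0)
  with φα , φβ , ∣α∣ , ∣β∣ ← support₀ t α β (n≤0⇒n≡0 ℓ≤0) =
  oneEntry x 0 (suc b) Qx (trans (cong (x * 0 +_) φα) (+-identityʳ _))
    (trans (cong (x * suc b +_) φβ) (+-identityʳ _)) ∣α∣ (trans (cong (suc b +_) ∣β∣) (+-identityʳ _))
support≤1 {t = x ∷ t} {suc a ∷ α} {b ∷ β} (Qx ∷ _) _ (s≤s ℓ≤0)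
  with φα , φβ , ∣α∣ , ∣β∣ ← support₀ t α β (n≤0⇒n≡0 ℓ≤0) =
  oneEntry x (suc a) b Qx (trans (cong (x * suc a +_) φα) (+-identityʳ _))
    (trans (cong (x * b +_) φβ) (+-identityʳ _))
    (trans (cong (suc a +_) ∣α∣) (+-identityʳ _)) (trans (cong (b +_) ∣β∣) (+-identityʳ _))

support≤2 : ∀ {Q : ℕ → Set} {n} {t α β : Vec ℕ n} {z} → All Q t → Q z →
            lenₑ (α +ₑ β) ≤ 2 → TwoEntries Q t α β
support≤2 {t = []} {[]} {[]} {z} [] Qz _ =
  twoEntries z z 0 0 0 0 Qz Qz (sym (cong₂ _+_ (*-zeroʳ z) (*-zeroʳ z)))
    (sym (cong₂ _+_ (*-zeroʳ z) (*-zeroʳ z))) refl refl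
support≤2 {t = x ∷ t} {zero ∷ α} {zero ∷ β} (_ ∷ Qt) Qz ℓ≤2
  with twoEntries y y′ a₁ a₂ b₁ b₂ Qy Qy′ φα φβ ∣α∣ ∣β∣ ← support≤2 Qt Qz ℓ≤2 =
  twoEntries y y′ a₁ a₂ b₁ b₂ Qy Qy′ (cong₂ _+_ (*-zeroʳ x) φα) (cong₂ _+_ (*-zeroʳ x) φβ) ∣α∣ ∣β∣
support≤2 {t = x ∷ t} {zero ∷ α} {suc b ∷ β} (Qx ∷ Qt) Qz (s≤s ℓ≤1)
  with oneEntry y a′ b′ Qy φα φβ ∣α∣ ∣β∣ ← support≤1 Qt Qz ℓ≤1 =
  twoEntries x y 0 a′ (suc b) b′ Qx Qy (cong (x * 0 +_) φα) (cong (x * suc b +_) φβ)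
    ∣α∣ (cong (suc b +_) ∣β∣)
support≤2 {t = x ∷ t} {suc a ∷ α} {b ∷ β} (Qx ∷ Qt) Qz (s≤s ℓ≤1)
  with oneEntry y a′ b′ Qy φα φβ ∣α∣ ∣β∣ ← support≤1 Qt Qz ℓ≤1 =
  twoEntries x y (suc a) a′ b b′ Qx Qy (cong (x * suc a +_) φα) (cong (x * b +_) φβ)
    (cong (suc a +_) ∣α∣) (cong (b +_) ∣β∣)

colouring : ∀ {r} (f : ℕ → ℕ) → (∀ x → f x < r) → ℕ → Fin r
colouring f f<r x = fromℕ< (f<r x)

monochromatic⇒constant : ∀ {r n} {f : ℕ → ℕ} (f<r : ∀ x → f x < r) {t : Vec ℕ n} →
                         Monochromatic (colouring f f<r) t → Σ ℕ λ κ → All (λ x → f x ≡ κ) t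
monochromatic⇒constant f<r (κ , mono) =
  toℕ κ , lookup⁻ λ i → trans (sym (toℕ-fromℕ< (f<r _))) (cong toℕ (proj₂ (mono i)))

All-≡⇒replicate : ∀ {n κ} {t : Vec ℕ n} → All (_≡ κ) t → t ≡ replicate n κ
All-≡⇒replicate []           = refl
All-≡⇒replicate (refl ∷ t≡κ) = cong (_ ∷_) (All-≡⇒replicate t≡κ)

-- φ(α) − c₁ = φ(β) − c₂, written without truncated subtraction.
MonochromaticOffsets : ∀ {n} → Vec ℕ n → Vec ℕ n → ℕ → ℕ → (Vec ℕ n → Set) → Set
MonochromaticOffsets {n} α β c₁ c₂ S =
  ∀ r (c : ℕ → Fin r) (L : List (Vec ℕ n)) →
  Σ (Vec ℕ n) λ t → t ∉ L × Monochromatic c t × S t × linMap t α + c₂ ≡ linMap t β + c₁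

MonochromaticOffsets-sym : ∀ {n} {α β : Vec ℕ n} {c₁ c₂ S} →
                           MonochromaticOffsets α β c₁ c₂ S → MonochromaticOffsets β α c₂ c₁ S
MonochromaticOffsets-sym offsets r c L with t , t∉L , mono , St , shifted ← offsets r c L =
  t , t∉L , mono , St , sym shifted

linMap-divMod : ∀ N .{{_ : NonZero N}} {κ n} (t α : Vec ℕ n) → All (λ x → x % N ≡ κ) t →
                linMap t α ≡ κ * ∣ α ∣ₑ + linMap (map (_/ N) t) α * N
linMap-divMod N {κ} []      []      []               = sym (trans (+-identityʳ (κ * 0)) (*-zeroʳ κ))
linMap-divMod N {κ} (x ∷ t) (a ∷ α) (x%N≡κ ∷ t%N≡κ) = begin
  x * a + linMap t α
    ≡⟨ cong₂ (λ u v → u * a + v) x≡ (linMap-divMod N t α t%N≡κ) ⟩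
  (κ + x / N * N) * a + (κ * ∣ α ∣ₑ + linMap (map (_/ N) t) α * N)
    ≡⟨ regroup κ (x / N) a ∣ α ∣ₑ (linMap (map (_/ N) t) α) N ⟩
  κ * (a + ∣ α ∣ₑ) + (x / N * a + linMap (map (_/ N) t) α) * N
    ∎
  where
  open ≡-Reasoning
  x≡ : x ≡ κ + x / N * N
  x≡ = trans (m≡m%n+[m/n]*n x N) (cong (_+ x / N * N) x%N≡κ)
  regroup : ∀ κ q a S L N → (κ + q * N) * a + (κ * S + L * N) ≡ κ * (a + S) + (q * a + L) * N
  regroup = solve-∀

equalResidues : ∀ {N} .{{_ : NonZero N}} {c₁ c₂ k₁ k₂} → c₁ < N → c₂ < N →
                c₁ + k₁ * N ≡ c₂ + k₂ * N → c₁ ≡ c₂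
equalResidues {N} {c₁} {c₂} {k₁} {k₂} c₁<N c₂<N eq = begin
  c₁                ≡⟨ m<n⇒m%n≡m c₁<N ⟨
  c₁ % N            ≡⟨ [m+kn]%n≡m%n c₁ k₁ N ⟨
  (c₁ + k₁ * N) % N ≡⟨ cong (_% N) eq ⟩
  (c₂ + k₂ * N) % N ≡⟨ [m+kn]%n≡m%n c₂ k₂ N ⟩
  c₂ % N            ≡⟨ m<n⇒m%n≡m c₂<N ⟩
  c₂                ∎
  where open ≡-Reasoning

-- If every tᵢ ≡ κ (mod N) then φ(γ) ≡ κ |γ| (mod N), so equal degrees give c₁ ≡ c₂ (mod N), and N > c₁, c₂.
equalDegrees⇒equalOffsets : ∀ {n} {α β : Vec ℕ n} {c₁ c₂ S} →
                            MonochromaticOffsets α β c₁ c₂ S → ∣ α ∣ₑ ≡ ∣ β ∣ₑ → c₁ ≡ c₂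
equalDegrees⇒equalOffsets {α = α} {β} {c₁} {c₂} offsets ∣α∣≡∣β∣
  with t , _ , mono , _ , shifted ← offsets _ (colouring (_% suc (c₁ + c₂)) λ x → m%n<n x _) []
  with κ , residues ← monochromatic⇒constant (λ x → m%n<n x _) mono =
  sym (equalResidues {k₁ = K₁} {k₂ = K₂} (s≤s (m≤n+m c₂ c₁)) (s≤s (m≤m+n c₁ c₂))
    (+-cancelˡ-≡ (κ * ∣ α ∣ₑ) _ _ (begin
      κ * ∣ α ∣ₑ + (c₂ + K₁ * N)  ≡⟨ swap-middle (κ * ∣ α ∣ₑ) c₂ (K₁ * N) ⟩
      κ * ∣ α ∣ₑ + K₁ * N + c₂    ≡⟨ cong (_+ c₂) (linMap-divMod N t α residues) ⟨
      linMap t α + c₂             ≡⟨ shifted ⟩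
      linMap t β + c₁             ≡⟨ cong (_+ c₁) (linMap-divMod N t β residues) ⟩
      κ * ∣ β ∣ₑ + K₂ * N + c₁    ≡⟨ cong (λ s → κ * s + K₂ * N + c₁) ∣α∣≡∣β∣ ⟨
      κ * ∣ α ∣ₑ + K₂ * N + c₁    ≡⟨ swap-middle (κ * ∣ α ∣ₑ) c₁ (K₂ * N) ⟨
      κ * ∣ α ∣ₑ + (c₁ + K₂ * N)  ∎)))
  where
  open ≡-Reasoning
  N K₁ K₂ : ℕ
  N  = suc (c₁ + c₂)
  K₁ = linMap (map (_/ N) t) α
  K₂ = linMap (map (_/ N) t) β
  swap-middle : ∀ a b c → a + (b + c) ≡ a + c + b
  swap-middle = solve-∀

nonempty : ∀ {P : ℕ → Set} {n} {t α β : Vec ℕ n} → ∣ β ∣ₑ < ∣ α ∣ₑ → All P t → Σ ℕ P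
nonempty {t = x ∷ _}         _  (Px ∷ _) = x , Px
nonempty {t = []} {[]} {[]} () []

module _ {n} {α β : Vec ℕ n} {c₁ c₂ : ℕ} {S : Vec ℕ n → Set}
         (offsets : MonochromaticOffsets α β c₁ c₂ S) (support : lenₑ (α +ₑ β) ≤ 2)
         (β<α : ∣ β ∣ₑ < ∣ α ∣ₑ) where

  private
    G K N : ℕ
    G = ∣ α ∣ₑ ∸ ∣ β ∣ₑ
    K = ∣ α ∣ₑ + ∣ β ∣ₑ
    N = suc (K !)

    1≤G : 1 ≤ G
    1≤G = m<n⇒0<n∸m β<α

    shift : ℕ → ℕ
    shift x = G * x + c₂ ∸ c₁

    c₁<Gx+c₂ : ∀ {x} → c₁ < x → c₁ < G * x + c₂
    c₁<Gx+c₂ {x} c₁<x = ≤-trans (≤-trans c₁<x (m≤n*m x G {{>-nonZero 1≤G}})) (m≤m+n (G * x) c₂)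

    shift+c₁ : ∀ {x} → c₁ < x → shift x + c₁ ≡ G * x + c₂
    shift+c₁ c₁<x = m∸n+n≡m (<⇒≤ (c₁<Gx+c₂ c₁<x))

    shift-lastDigit : ∀ {x} → c₁ < x → LastDigit N (shift x) (lastDigit N (shift x))
    shift-lastDigit {x} c₁<x =
      lastDigitWithin-spec N (s≤s (1≤n! K)) (shift x) (shift x) (m<n⇒0<n∸m (c₁<Gx+c₂ c₁<x)) ≤-refl

    colour : ℕ → ℕ
    colour x with x ≤? c₁
    ... | yes _ = x
    ... | no  _ = suc c₁ + lastDigit N (shift x)

    colour<r : ∀ x → colour x < suc c₁ + N
    colour<r x with x ≤? c₁
    ... | yes x≤c₁ = ≤-trans (s≤s x≤c₁) (m≤m+n (suc c₁) N)
    ... | no  _    = +-monoʳ-< (suc c₁) (lastDigitWithin<N N (shift x) (shift x))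

    colour-large : ∀ {x} → c₁ < x → colour x ≡ suc c₁ + lastDigit N (shift x)
    colour-large {x} c₁<x with x ≤? c₁
    ... | yes x≤c₁ = ⊥-elim (<⇒≱ c₁<x x≤c₁)
    ... | no  _    = refl

    colour-small : ∀ {x} → x ≤ c₁ → colour x ≡ x
    colour-small {x} x≤c₁ with x ≤? c₁
    ... | yes _    = refl
    ... | no  x≰c₁ = ⊥-elim (x≰c₁ x≤c₁)

    small-colour : ∀ {x κ} → colour x ≡ κ → κ ≤ c₁ → x ≡ κ
    small-colour {x} colour≡κ κ≤c₁ with x ≤? c₁
    ... | yes _ = colour≡κ
    ... | no  _ = ⊥-elim (<⇒≱ (s≤s (m≤m+n c₁ _)) (subst (_≤ c₁) (sym colour≡κ) κ≤c₁))

    -- Values up to c₁ have colours of their own, so a monochromatic t with such an entry is constant.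
    constants : List (Vec ℕ n)
    constants = List.map (replicate n) (upTo (suc c₁))

    largeEntries : ∀ {t κ} → t ∉ constants → All (λ x → colour x ≡ κ) t → All (c₁ <_) t
    largeEntries {t} {κ} t∉constants sameColour = lookup⁻ large
      where
      large : ∀ i → c₁ < lookup t i
      large i with c₁ <? lookup t i
      ... | yes c₁<tᵢ = c₁<tᵢ
      ... | no  c₁≮tᵢ =
        ⊥-elim (t∉constants (subst (_∈ constants) (sym t≡κ) (∈-map⁺ (replicate n) (∈-upTo⁺ (s≤s κ≤c₁)))))
        where
        tᵢ≤c₁ : lookup t i ≤ c₁
        tᵢ≤c₁ = ≮⇒≥ c₁≮tᵢ
        κ≤c₁ : κ ≤ c₁
        κ≤c₁ = subst (_≤ c₁) (trans (sym (colour-small tᵢ≤c₁)) (lookup⁺ sameColour i)) tᵢ≤c₁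
        t≡κ : t ≡ replicate n κ
        t≡κ = All-≡⇒replicate (All.map (λ colour≡κ → small-colour colour≡κ κ≤c₁) sameColour)

  smallerDegree-impossible : ⊥
  smallerDegree-impossible
    with t , t∉constants , mono , _ , shifted ← offsets _ (colouring colour colour<r) constants
    with κ , sameColour ← monochromatic⇒constant colour<r mono
    with Qt ← zip (largeEntries t∉constants sameColour , sameColour)
    with twoEntries x y a₁ a₂ b₁ b₂ (c₁<x , x-colour) (c₁<y , y-colour) φα φβ ∣α∣ ∣β∣
           ← support≤2 Qt (proj₂ (nonempty {α = α} {β} β<α Qt)) support =
    noHomogeneousSolution (suc-!-coprimeUpTo K) 1≤G {a₁} {a₂} {b₁} {b₂} sums (subst (_≤ K) ∣α∣ (m≤m+n _ _))
      (m<n⇒0<n∸m (c₁<Gx+c₂ c₁<x)) (m<n⇒0<n∸m (c₁<Gx+c₂ c₁<y))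
      (shift-lastDigit c₁<x) (subst (LastDigit N (shift y)) sameDigit (shift-lastDigit c₁<y))
      (homogenise {a₁} {a₂} {b₁} {b₂} {x} {y} equation sums (shift+c₁ c₁<x) (shift+c₁ c₁<y))
    where
    sameDigit : lastDigit N (shift y) ≡ lastDigit N (shift x)
    sameDigit = +-cancelˡ-≡ (suc c₁) _ _
      (trans (sym (colour-large c₁<y)) (trans y-colour (trans (sym x-colour) (colour-large c₁<x))))
    sums : a₁ + a₂ ≡ b₁ + b₂ + G
    sums = trans (sym ∣α∣) (trans (sym (m+[n∸m]≡n (<⇒≤ β<α))) (cong (_+ G) ∣β∣))
    equation : x * a₁ + y * a₂ + c₂ ≡ x * b₁ + y * b₂ + c₁
    equation = trans (cong (_+ c₂) (sym φα)) (trans shifted (cong (_+ c₁) φβ))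

offsets⇒equalDegrees : ∀ {n} {α β : Vec ℕ n} {c₁ c₂ S} → MonochromaticOffsets α β c₁ c₂ S →
                       lenₑ (α +ₑ β) ≤ 2 → ∣ α ∣ₑ ≡ ∣ β ∣ₑ
offsets⇒equalDegrees {α = α} {β} offsets support with <-cmp ∣ α ∣ₑ ∣ β ∣ₑ
... | tri< α<β _ _ = ⊥-elim (smallerDegree-impossible (MonochromaticOffsets-sym offsets)
                       (subst (λ γ → lenₑ γ ≤ 2) (zipWith-comm +-comm α β) support) α<β)
... | tri≈ _ α≡β _ = α≡β
... | tri> _ _ β<α = ⊥-elim (smallerDegree-impossible offsets support β<α)

equalOffsets⇒collision : ∀ {n} {α β : Vec ℕ n} {c₁ c₂ S} →
                         MonochromaticOffsets α β c₁ c₂ S → c₁ ≡ c₂ →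
                         Σ (Vec ℕ n) λ t → S t × linMap t α ≡ linMap t β
equalOffsets⇒collision offsets refl with t , _ , _ , St , shifted ← offsets 1 (λ _ → Fin.zero) [] =
  t , St , +-cancelʳ-≡ _ _ _ shifted

strictMono⇒injective : ∀ {k} (M : Fin k → ℕ) → (∀ i j → i Fin.< j → M i < M j) → Injective _≡_ _≡_ M
strictMono⇒injective M mono {i} {j} Mi≡Mj with <-cmpᶠ i j
... | tri< i<j _ _ = ⊥-elim (<⇒≢ (mono i j i<j) Mi≡Mj)
... | tri≈ _ i≡j _ = i≡j
... | tri> _ _ j<i = ⊥-elim (<⇒≢ (mono j i j<i) (sym Mi≡Mj))

opposite-injective : ∀ {k} → Injective _≡_ _≡_ (Fin.opposite {k})
opposite-injective {_} {i} {j} eq =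
  trans (sym (opposite-involutive i)) (trans (cong Fin.opposite eq) (opposite-involutive j))

partition-value : ∀ {n ℓ} {P : Poly n} {φ : Exponent n → ℕ} {J : Fin (suc ℓ) → Exponent n → Set} {M} →
                  PartitionBy P φ J M → ∀ {k γ} → J k γ → φ γ ≡ M k
partition-value (_ , _ , _ , J⇔) {k} {γ} Jkγ = proj₂ (Equivalence.to (J⇔ k γ) Jkγ)

∸≡⇒≡+ : ∀ {a b d} → a ∸ b ≡ d → 1 ≤ d → a ≡ b + d
∸≡⇒≡+ {a} {b} refl 1≤a∸b = sym (m+[n∸m]≡n (<⇒≤ (m∸n≢0⇒n<m {a} {b} (m<n⇒n≢0 1≤a∸b))))

-- Common content of lower and upper Rado functionals: φ equals M k on J k, and M₀, …, M_m
-- lie at offsets o, independent of φ, from a base point.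
LevelOffsets : ∀ {n ℓ} → (Fin (suc ℓ) → Exponent n → Set) → (m : ℕ) →
               ((k : Fin (suc ℓ)) → toℕ k ≤ m → ℕ) → Set
LevelOffsets {n} {ℓ} J m o =
  ∀ r (c : ℕ → Fin r) (L : List (Vec ℕ n)) →
  Σ (Vec ℕ n) λ t → t ∉ L × Monochromatic c t ×
  Σ (Fin (suc ℓ) → ℕ) λ M → Injective _≡_ _≡_ M × (∀ {k γ} → J k γ → linMap t γ ≡ M k) ×
  Σ ℕ λ base → ∀ k (k≤m : toℕ k ≤ m) → M k ≡ base + o k k≤m

lowerOffset : ∀ {ℓ m} → (Fin m → ℕ) → (k : Fin (suc ℓ)) → toℕ k ≤ m → ℕ
lowerOffset d Fin.zero    _   = 0
lowerOffset d (Fin.suc k) k<m = d (fromℕ< k<m)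

upperOffset : ∀ {ℓ m} → (Fin m → ℕ) → (k : Fin (suc ℓ)) → toℕ k ≤ m → ℕ
upperOffset d k k≤m with m≤n⇒m<n∨m≡n k≤m
... | inj₁ k<m = d (fromℕ< k<m)
... | inj₂ _   = 0

lowerRado⇒levels : ∀ {n} {P : Poly n} {ℓ m J d} → LowerRado P ℓ m J d → LevelOffsets J m (lowerOffset d)
lowerRado⇒levels {P = P} {d = d} (_ , d≥1 , rado) r c L
  with t , t∉L , mono , M , partition , M-d , _ ← rado r c 0 L =
  t , t∉L , mono , M , strictMono⇒injective M (proj₁ partition) , partition-value {P = P} partition ,
  M Fin.zero , offset
  where
  offset : ∀ k k≤m → M k ≡ M Fin.zero + lowerOffset d k k≤m
  offset Fin.zero    _   = sym (+-identityʳ _)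
  offset (Fin.suc k) k<m = ∸≡⇒≡+ (M-d (Fin.suc k) (fromℕ< k<m) (cong suc (sym (toℕ-fromℕ< k<m)))) (d≥1 _)

upperRado⇒levels : ∀ {n} {P : Poly n} {ℓ m J d} → UpperRado P ℓ m J d → LevelOffsets J m (upperOffset d)
upperRado⇒levels {P = P} {ℓ} {m} {J} {d} (m≤ℓ , d≥1 , rado) r c L
  with t , t∉L , mono , M , partition , M-d , _ ← rado r c 0 L =
  t , t∉L , mono , M , injective , value , M top , offset
  where
  top : Fin (suc ℓ)
  top = fromℕ< (s≤s m≤ℓ)
  oppositeM : ∀ k → M (Fin.opposite (Fin.opposite k)) ≡ M k
  oppositeM k = cong M (opposite-involutive k)
  injective : Injective _≡_ _≡_ M
  injective {i} {j} Mi≡Mj = opposite-injective (strictMono⇒injective (M ∘ Fin.opposite) (proj₁ partition)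
    (trans (oppositeM i) (trans Mi≡Mj (sym (oppositeM j)))))
  value : ∀ {k γ} → J k γ → linMap t γ ≡ M k
  value {k} {γ} Jkγ = trans (partition-value {P = P} partition {Fin.opposite k}
    (subst (λ k′ → J k′ γ) (sym (opposite-involutive k)) Jkγ)) (oppositeM k)
  offset : ∀ k k≤m → M k ≡ M top + upperOffset d k k≤m
  offset k k≤m with m≤n⇒m<n∨m≡n k≤m
  ... | inj₁ k<m = ∸≡⇒≡+ (M-d k top (fromℕ< k<m) (sym (toℕ-fromℕ< k<m)) (toℕ-fromℕ< (s≤s m≤ℓ))) (d≥1 _)
  ... | inj₂ k≡m =
    trans (cong M (toℕ-injective (trans k≡m (sym (toℕ-fromℕ< (s≤s m≤ℓ)))))) (sym (+-identityʳ _))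

rado⇒levels : ∀ {n} {P : Poly n} {ℓ m J d} → UpperRado P ℓ m J d ⊎ LowerRado P ℓ m J d →
              Σ ((k : Fin (suc ℓ)) → toℕ k ≤ m → ℕ) (LevelOffsets J m)
rado⇒levels {P = P} (inj₁ upper) = _ , upperRado⇒levels {P = P} upper
rado⇒levels {P = P} (inj₂ lower) = _ , lowerRado⇒levels {P = P} lower

levels⇒offsets : ∀ {n ℓ m} {J : Fin (suc ℓ) → Exponent n → Set} {o} {i j α β} → LevelOffsets J m o →
                 J i α → J j β → (i≤m : toℕ i ≤ m) (j≤m : toℕ j ≤ m) →
                 MonochromaticOffsets α β (o i i≤m) (o j j≤m) (λ t → linMap t α ≡ linMap t β → i ≡ j)
levels⇒offsets {o = o} {i} {j} {α} {β} levels Jiα Jjβ i≤m j≤m r c L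
  with t , t∉L , mono , M , injective , value , base , offset ← levels r c L =
  t , t∉L , mono , separates , shifted
  where
  open ≡-Reasoning
  separates : linMap t α ≡ linMap t β → i ≡ j
  separates φα≡φβ = injective (trans (sym (value Jiα)) (trans φα≡φβ (value Jjβ)))
  swap : ∀ a b c → a + b + c ≡ a + c + b
  swap = solve-∀
  shifted : linMap t α + o j j≤m ≡ linMap t β + o i i≤m
  shifted = begin
    linMap t α + o j j≤m         ≡⟨ cong (_+ o j j≤m) (trans (value Jiα) (offset i i≤m)) ⟩
    base + o i i≤m + o j j≤m     ≡⟨ swap base (o i i≤m) (o j j≤m) ⟩
    base + o j j≤m + o i i≤m     ≡⟨ cong (_+ o i i≤m) (trans (value Jjβ) (offset j j≤m)) ⟨
    linMap t β + o i i≤m         ∎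

corollary2p27 : ∀ {n : ℕ} (P : Poly n) (ℓ m : ℕ)
    (J : Fin (suc ℓ) → Exponent n → Set) (d : Fin m → ℕ) →
    UpperRado P ℓ m J d ⊎ LowerRado P ℓ m J d →
    ∀ (i j : Fin (suc ℓ)) → toℕ i ≤ m → toℕ j ≤ m →
    ∀ (α β : Exponent n) → J i α → J j β → lenₑ (α +ₑ β) ≤ 2 →
    (i ≡ j) × (∣ α ∣ₑ ≡ ∣ β ∣ₑ)
corollary2p27 P ℓ m J d rado i j i≤m j≤m α β Jiα Jjβ support
  with o , levels ← rado⇒levels {P = P} rado = i≡j , degrees
  where
  offsets : MonochromaticOffsets α β (o i i≤m) (o j j≤m) (λ t → linMap t α ≡ linMap t β → i ≡ j)
  offsets = levels⇒offsets levels Jiα Jjβ i≤m j≤m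
  degrees : ∣ α ∣ₑ ≡ ∣ β ∣ₑ
  degrees = offsets⇒equalDegrees offsets support
  i≡j : i ≡ j
  i≡j with _ , separates , collision ←
             equalOffsets⇒collision offsets (equalDegrees⇒equalOffsets offsets degrees) =
    separates collision
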